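{- For every odd $r\ge 3$, $\zeta_e(BF(r))\le \left\lceil \frac{r}{2}\right\rceil 2^{r-1}$.
   Context: The $r$-dimensional butterfly network $BF(r)$ has vertex set $\{[w;i] : w\in\{0,1\}^r,\ 0\le i\le r\}$, and $[w;i]$ is adjacent to $[w';j]$ iff $j=i+1$ and either $w=w'$ or $w$ and $w'$ differ precisely in the $j$-th bit. Forcing (closure) rule: for a graph $G=(V,E)$ and $T\subseteq V$, the closure $C_G(T)$ starts as $T$ and, as long as some vertex of $C_G(T)$ has exactly one neighbor not in $C_G(T)$, that neighbor is added. Edge-forcing set: a set $K$ of pairwise independent edges of $G$ such that, with $T$ the set of endpoints of edges of $K$, $C_G(T)=V$. $\zeta_e(G)$ is the minimum cardinality of an edge-forcing set of $G$. -}

module Defs where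

open import Data.Nat using (ℕ; suc; _≤_)
open import Data.Bool using (Bool; not)
open import Data.Fin using (Fin; inject₁) renaming (suc to fsuc)
open import Data.Vec using (Vec; updateAt)
open import Data.Product using (Σ; _×_; _,_; proj₁; proj₂)
open import Data.Sum using (_⊎_)
open import Data.List using (List; length)
open import Data.List.Relation.Unary.Any using (Any)
open import Data.List.Relation.Unary.AllPairs using (AllPairs)
open import Relation.Binary.PropositionalEquality using (_≡_; _≢_)

data Closure {V : Set} (Adj : V → V → Set) (T : V → Set) : V → Set where
  base  : ∀ {v} → T v → Closure Adj T v
  force : ∀ {u v} → Closure Adj T u → Adj u v →
          (∀ x → Adj u x → x ≢ v → Closure Adj T x) →
          Closure Adj T v

Edge : {V : Set} → (V → V → Set) → Set
Edge {V} Adj = Σ (V × V) λ p → Adj (proj₁ p) (proj₂ p)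

Independent : {V : Set} {Adj : V → V → Set} → Edge Adj → Edge Adj → Set
Independent ((a , b) , _) ((c , d) , _) = a ≢ c × a ≢ d × b ≢ c × b ≢ d

Endpoint : {V : Set} {Adj : V → V → Set} → List (Edge Adj) → V → Set
Endpoint K v = Any (λ e → v ≡ proj₁ (proj₁ e) ⊎ v ≡ proj₂ (proj₁ e)) K

IsEdgeForcingSet : {V : Set} (Adj : V → V → Set) → List (Edge Adj) → Set
IsEdgeForcingSet {V} Adj K =
  AllPairs Independent K × (∀ (v : V) → Closure Adj (Endpoint K) v)

-- ζ_e(G) ≤ m  (ζ_e is the minimum cardinality of an edge-forcing set;
-- pairwise independent edges are distinct, so |K| = length K).
ζₑ≤ : {V : Set} (Adj : V → V → Set) → ℕ → Set
ζₑ≤ Adj m = Σ (List (Edge Adj)) λ K → IsEdgeForcingSet Adj K × length K ≤ m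

-- Butterfly network BF(r).  Vertex [w;i] with w ∈ {0,1}^r, 0 ≤ i ≤ r.

BFVertex : ℕ → Set
BFVertex r = Vec Bool r × Fin (suc r)

-- flip bit at 0-based position k (= 1-based bit k+1)
flipBit : ∀ {r} → Fin r → Vec Bool r → Vec Bool r
flipBit k w = updateAt w k not

-- Up [w;i] [w';i+1]: level j = i+1 = k+1 (1-based bit j = 0-based k),
-- with w' = w or w' differing from w exactly in bit j.
data BFUp {r : ℕ} : BFVertex r → BFVertex r → Set where
  straight : ∀ (w : Vec Bool r) (k : Fin r) → BFUp (w , inject₁ k) (w , fsuc k)
  cross    : ∀ (w : Vec Bool r) (k : Fin r) → BFUp (w , inject₁ k) (flipBit k w , fsuc k)

BFAdj : ∀ r → BFVertex r → BFVertex r → Set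
BFAdj r u v = BFUp u v ⊎ BFUp v u

-- Write r = 2m + 1 and take the straight edges [w;k]–[w;k+1] with k even and
-- bit k of w equal to 0: for each of the m + 1 even k there are 2^(r-1) of
-- them, and they are pairwise independent. Their endpoints force everything.
-- An odd level k + 1 is filled from the bottom up: a missing [w;k+1] is the
-- only unknown neighbour of the endpoint [w';k], w' = w with bit k flipped,
-- whose lower neighbours are already known. An even level k is then filled
-- from the top down: a missing [w;k] is the only unknown neighbour of
-- [w;k+1], whose upper neighbours are already known.
module Submission where

open import Defs
open import Data.Nat using (ℕ; _≤_; _*_; _^_; _∸_; _%_; ⌈_/2⌉)
open import Relation.Binary.PropositionalEquality using (_≡_)

open import Data.Nat using (zero; suc; _+_; _<_; ⌊_/2⌋; s≤s; s≤s⁻¹)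
open import Data.Nat.Properties
  using (suc-injective; even≢odd; *-comm; *-cancelʳ-≡; *-cancelʳ-<; *-monoˡ-≤;
         +-identityʳ; +-suc; m≤m+n; m+[n∸m]≡n; <-irrefl; ≤-reflexive)
open import Data.Nat.DivMod using (_/_; m≡m%n+[m/n]*n)
open import Data.Bool using (Bool; true; false; not)
open import Data.Bool.Properties using (not-involutive)
open import Data.Fin using (Fin; toℕ; inject₁; lower₁) renaming (zero to fzero; suc to fsuc)
open import Data.Fin.Properties
  using (toℕ-injective; toℕ-inject₁; inject₁-injective; inject₁-lower₁; toℕ<n)
  renaming (suc-injective to fsuc-injective)
open import Data.Vec using (Vec; []; _∷_; lookup; insertAt; removeAt)
open import Data.Vec.Properties
  using (∷-injective; lookup∘updateAt; updateAt-updateAt; updateAt-id-local;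
         removeAt-insertAt; insertAt-removeAt)
open import Data.List using (List; []; _∷_; _++_; map; length; allFin; cartesianProductWith; cartesianProduct)
open import Data.List.Properties using (length-++; length-map; length-tabulate)
open import Data.List.Membership.Propositional using (_∈_; lose)
open import Data.List.Membership.Propositional.Properties
  using (∈-map⁺; ∈-cartesianProductWith⁺; ∈-cartesianProduct⁺; ∈-allFin)
open import Data.List.Relation.Unary.Any using (here; there)
open import Data.List.Relation.Unary.All using ([]; _∷_)
open import Data.List.Relation.Unary.AllPairs as AllPairs using (AllPairs; []; _∷_)
import Data.List.Relation.Unary.AllPairs.Properties as AllPairs
open import Data.List.Relation.Unary.Unique.Propositional using (Unique)
import Data.List.Relation.Unary.Unique.Propositional.Properties as Unique
import Data.Product as Product
open import Data.Product using (Σ; ∃-syntax; _×_; _,_; proj₁; proj₂)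
open import Data.Sum using (_⊎_; inj₁; inj₂)
open import Data.Empty using (⊥-elim)
open import Function using (_∘_; id)
open import Relation.Binary.PropositionalEquality
  using (_≢_; refl; sym; trans; cong; cong₂; subst; module ≡-Reasoning)

*2≢1+*2 : ∀ a b → a * 2 ≢ suc (b * 2)
*2≢1+*2 a b e = even≢odd a b (trans (*-comm 2 a) (trans e (cong suc (*-comm b 2))))

even-or-odd : ∀ n → (∃[ s ] n ≡ s * 2) ⊎ (∃[ s ] n ≡ suc (s * 2))
even-or-odd zero = inj₁ (0 , refl)
even-or-odd (suc n) with even-or-odd n
... | inj₁ (s , refl) = inj₂ (s , refl)
... | inj₂ (s , refl) = inj₁ (suc s , refl)

⌊n*2/2⌋≡n : ∀ n → ⌊ n * 2 /2⌋ ≡ n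
⌊n*2/2⌋≡n zero = refl
⌊n*2/2⌋≡n (suc n) = cong suc (⌊n*2/2⌋≡n n)

double : ∀ {m} → Fin (suc m) → Fin (suc (m * 2))
double fzero = fzero
double {suc m} (fsuc t) = fsuc (fsuc (double t))

toℕ-double : ∀ {m} (t : Fin (suc m)) → toℕ (double t) ≡ toℕ t * 2
toℕ-double fzero = refl
toℕ-double {suc m} (fsuc t) = cong (suc ∘ suc) (toℕ-double t)

double-injective : ∀ {m} {t t′ : Fin (suc m)} → double t ≡ double t′ → t ≡ t′
double-injective {t = t} {t′} e = toℕ-injective
  (*-cancelʳ-≡ (toℕ t) (toℕ t′) 2 (trans (sym (toℕ-double t)) (trans (cong toℕ e) (toℕ-double t′))))

double≢suc-double : ∀ {m} (t t′ : Fin (suc m)) → toℕ (double t) ≢ suc (toℕ (double t′))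
double≢suc-double t t′ e =
  *2≢1+*2 (toℕ t) (toℕ t′) (trans (sym (toℕ-double t)) (trans e (cong suc (toℕ-double t′))))

double-onto-even : ∀ {m} (k : Fin (suc (m * 2))) s → toℕ k ≡ s * 2 → Σ (Fin (suc m)) λ t → double t ≡ k
double-onto-even fzero zero refl = fzero , refl
double-onto-even {suc m} (fsuc (fsuc k)) (suc s) e
  with double-onto-even {m} k s (suc-injective (suc-injective e))
... | t , refl = fsuc t , refl
double-onto-even {zero} (fsuc ()) s e
double-onto-even {suc m} (fsuc fzero) zero ()
double-onto-even {suc m} (fsuc fzero) (suc s) ()
double-onto-even {suc m} (fsuc (fsuc k)) zero ()

inject₁-onto : ∀ {n} (l : Fin (suc n)) → toℕ l < n → ∃[ k ] inject₁ k ≡ l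
inject₁-onto l l<n = lower₁ l n≢l , inject₁-lower₁ l n≢l
  where n≢l = λ e → <-irrefl (sym e) l<n

insertAt-injective : ∀ {A : Set} {n} {xs ys : Vec A n} i x →
                     insertAt xs i x ≡ insertAt ys i x → xs ≡ ys
insertAt-injective {xs = xs} {ys} i x e = begin
  xs                                ≡⟨ sym (removeAt-insertAt xs i x) ⟩
  removeAt (insertAt xs i x) i      ≡⟨ cong (λ zs → removeAt zs i) e ⟩
  removeAt (insertAt ys i x) i      ≡⟨ removeAt-insertAt ys i x ⟩
  ys                                ∎
  where open ≡-Reasoning

length-cartesianProductWith : ∀ {A B C : Set} (f : A → B → C) xs ys →
  length (cartesianProductWith f xs ys) ≡ length xs * length ys
length-cartesianProductWith f [] ys = refl
length-cartesianProductWith f (x ∷ xs) ys = begin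
  length (map (f x) ys ++ cartesianProductWith f xs ys)
    ≡⟨ length-++ (map (f x) ys) ⟩
  length (map (f x) ys) + length (cartesianProductWith f xs ys)
    ≡⟨ cong₂ _+_ (length-map (f x) ys) (length-cartesianProductWith f xs ys) ⟩
  length ys + length xs * length ys
    ∎
  where open ≡-Reasoning

allVecs : ∀ n → List (Vec Bool n)
allVecs zero = [] ∷ []
allVecs (suc n) = cartesianProductWith _∷_ (true ∷ false ∷ []) (allVecs n)

∈-allVecs : ∀ {n} (w : Vec Bool n) → w ∈ allVecs n
∈-allVecs [] = here refl
∈-allVecs (b ∷ w) = ∈-cartesianProductWith⁺ _∷_ (∈-bits b) (∈-allVecs w)
  where
    ∈-bits : ∀ b → b ∈ true ∷ false ∷ []
    ∈-bits true = here refl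
    ∈-bits false = there (here refl)

allVecs-unique : ∀ n → Unique (allVecs n)
allVecs-unique zero = [] ∷ []
allVecs-unique (suc n) =
  Unique.cartesianProductWith⁺ _∷_ ∷-injective (((λ ()) ∷ []) ∷ [] ∷ []) (allVecs-unique n)

length-allVecs : ∀ n → length (allVecs n) ≡ 2 ^ n
length-allVecs zero = refl
length-allVecs (suc n) =
  trans (length-cartesianProductWith _∷_ (true ∷ false ∷ []) (allVecs n)) (cong (2 *_) (length-allVecs n))

endpoints-of-∈ : ∀ {V : Set} {Adj : V → V → Set} {K : List (Edge Adj)} {e} → e ∈ K →
                 Endpoint K (proj₁ (proj₁ e)) × Endpoint K (proj₂ (proj₁ e))
endpoints-of-∈ e∈K = lose e∈K (inj₁ refl) , lose e∈K (inj₂ refl)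

flipBit-involutive : ∀ {r} (k : Fin r) (w : Vec Bool r) → flipBit k (flipBit k w) ≡ w
flipBit-involutive k w =
  trans (updateAt-updateAt k w) (updateAt-id-local k w (not-involutive (lookup w k)))

lookup-flipBit : ∀ {r} (k : Fin r) (w : Vec Bool r) → lookup (flipBit k w) k ≡ not (lookup w k)
lookup-flipBit k w = lookup∘updateAt k w

level : ∀ {r} → BFVertex r → ℕ
level = toℕ ∘ proj₂

BFUp-level : ∀ {r} {u x : BFVertex r} → BFUp u x → level x ≡ suc (level u)
BFUp-level (straight w k) = cong suc (sym (toℕ-inject₁ k))
BFUp-level (cross w k) = cong suc (sym (toℕ-inject₁ k))

BFUp-from : ∀ {r} {u x : BFVertex r} {k} → BFUp u x → proj₂ u ≡ inject₁ k →
            x ≡ (proj₁ u , fsuc k) ⊎ x ≡ (flipBit k (proj₁ u) , fsuc k)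
BFUp-from (straight w k) e with inject₁-injective e
... | refl = inj₁ refl
BFUp-from (cross w k) e with inject₁-injective e
... | refl = inj₂ refl

BFUp-into : ∀ {r} {x u : BFVertex r} {k} → BFUp x u → proj₂ u ≡ fsuc k →
            x ≡ (proj₁ u , inject₁ k) ⊎ x ≡ (flipBit k (proj₁ u) , inject₁ k)
BFUp-into (straight w k) e with fsuc-injective e
... | refl = inj₁ refl
BFUp-into (cross w k) e with fsuc-injective e
... | refl = inj₂ (cong (_, inject₁ k) (sym (flipBit-involutive k w)))

straightEdge : ∀ {r} → Fin r → Vec Bool r → Edge (BFAdj r)
straightEdge k w = ((w , inject₁ k) , (w , fsuc k)) , inj₁ (straight w k)

straightEdge-independent : ∀ {r} {k k′ : Fin r} {w w′} → (k ≡ k′ → w ≢ w′) →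
  toℕ k ≢ suc (toℕ k′) → suc (toℕ k) ≢ toℕ k′ →
  Independent (straightEdge k w) (straightEdge k′ w′)
straightEdge-independent {k = k} {k′} distinct k≢k′+1 k+1≢k′ =
    (λ e → distinct (inject₁-injective (cong proj₂ e)) (cong proj₁ e))
  , (λ e → k≢k′+1 (trans (sym (toℕ-inject₁ k)) (cong level e)))
  , (λ e → k+1≢k′ (trans (cong level e) (toℕ-inject₁ k′)))
  , (λ e → distinct (fsuc-injective (cong proj₂ e)) (cong proj₁ e))

CoversEvenStraightEdges : ∀ {r} → (BFVertex r → Set) → Set
CoversEvenStraightEdges {r} T = ∀ s (k : Fin r) w → toℕ k ≡ s * 2 → lookup w k ≡ false →
  T (w , inject₁ k) × T (w , fsuc k)

module Forcing (m : ℕ) {T : BFVertex (suc (m * 2)) → Set} (covers : CoversEvenStraightEdges T) where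

  r : ℕ
  r = suc (m * 2)

  C : BFVertex r → Set
  C = Closure (BFAdj r) T

  closure-covers : CoversEvenStraightEdges C
  closure-covers s k w k-even bit = Product.map base base (covers s k w k-even bit)

  LevelIn : ℕ → Set
  LevelIn n = ∀ v → level v ≡ n → C v

  DownClosed : ℕ → Set
  DownClosed n = ∀ {x u} → BFUp x u → level u ≡ n → C x

  UpClosed : ℕ → Set
  UpClosed n = ∀ {u x} → BFUp u x → level u ≡ n → C x

  levelIn⇒downClosed : ∀ {n} → LevelIn n → DownClosed (suc n)
  levelIn⇒downClosed known {x} up e = known x (suc-injective (trans (sym (BFUp-level up)) e))

  levelIn⇒upClosed : ∀ {n} → LevelIn (suc n) → UpClosed n
  levelIn⇒upClosed known {x = x} up e = known x (trans (BFUp-level up) (cong suc e))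

  downClosed-bottom : DownClosed 0
  downClosed-bottom up e with () ← trans (sym (BFUp-level up)) e

  upClosed-top : UpClosed r
  upClosed-top {x = x} up e = ⊥-elim (<-irrefl (trans (BFUp-level up) (cong suc e)) (toℕ<n (proj₂ x)))

  oddStep : ∀ s → DownClosed (s * 2) → ∀ w k → toℕ k ≡ s * 2 → C (w , fsuc k)
  oddStep s below w k k-even with lookup w k in bit
  ... | false = proj₂ (closure-covers s k w k-even bit)
  ... | true = force (proj₁ (closure-covers s k w̃ k-even w̃-bit)) (inj₁ up) others
    where
      w̃ = flipBit k w
      w̃-bit : lookup w̃ k ≡ false
      w̃-bit = trans (lookup-flipBit k w) (cong not bit)
      up : BFUp (w̃ , inject₁ k) (w , fsuc k)
      up = subst (λ w′ → BFUp (w̃ , inject₁ k) (w′ , fsuc k)) (flipBit-involutive k w) (cross w̃ k)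
      others : ∀ x → BFAdj r (w̃ , inject₁ k) x → x ≢ (w , fsuc k) → C x
      others x (inj₁ up′) x≢w with BFUp-from up′ refl
      ... | inj₁ refl = proj₂ (closure-covers s k w̃ k-even w̃-bit)
      ... | inj₂ refl = ⊥-elim (x≢w (cong (_, fsuc k) (flipBit-involutive k w)))
      others x (inj₂ down) _ = below down (trans (toℕ-inject₁ k) k-even)

  oddLevels : ∀ s → LevelIn (suc (s * 2))
  oddLevels zero (w , fsuc k) lv = oddStep zero downClosed-bottom w k (suc-injective lv)
  oddLevels (suc s) (w , fsuc k) lv =
    oddStep (suc s) (levelIn⇒downClosed (oddLevels s)) w k (suc-injective lv)

  evenStep : ∀ s → UpClosed (suc (s * 2)) → ∀ w k → toℕ k ≡ s * 2 → C (w , inject₁ k)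
  evenStep s above w k k-even with lookup w k in bit
  ... | false = proj₁ (closure-covers s k w k-even bit)
  ... | true = force (oddLevels s (w , fsuc k) (cong suc k-even)) (inj₂ (straight w k)) others
    where
      others : ∀ x → BFAdj r (w , fsuc k) x → x ≢ (w , inject₁ k) → C x
      others x (inj₁ up) _ = above up (cong suc k-even)
      others x (inj₂ down) x≢w with BFUp-into down refl
      ... | inj₁ refl = ⊥-elim (x≢w refl)
      ... | inj₂ refl = proj₁ (closure-covers s k (flipBit k w) k-even (trans (lookup-flipBit k w) (cong not bit)))

  even-level<r : ∀ {s} j → s + j ≡ m → s * 2 < r
  even-level<r {s} j s+j≡m = s≤s (*-monoˡ-≤ 2 (subst (s ≤_) s+j≡m (m≤m+n s j)))

  -- Downward induction: j counts the even levels strictly above level s * 2.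
  evenLevels : ∀ j s → s + j ≡ m → LevelIn (s * 2)
  evenLevels j s s+j≡m (w , l) lv with inject₁-onto l (subst (_< r) (sym lv) (even-level<r j s+j≡m))
  ... | k , refl = evenStep s (above j s+j≡m) w k (trans (sym (toℕ-inject₁ k)) lv)
    where
      above : ∀ j → s + j ≡ m → UpClosed (suc (s * 2))
      above zero e = subst (λ n → UpClosed (suc (n * 2))) (trans (sym e) (+-identityʳ s)) upClosed-top
      above (suc j) e = levelIn⇒upClosed (evenLevels j (suc s) (trans (sym (+-suc s j)) e))

  closure-total : ∀ v → C v
  closure-total v with even-or-odd (level v)
  ... | inj₂ (s , e) = oddLevels s v e
  ... | inj₁ (s , e) = evenLevels (m ∸ s) s (m+[n∸m]≡n s≤m) v e
    where s≤m = s≤s⁻¹ (*-cancelʳ-< 2 s (suc m) (subst (_< suc r) e (toℕ<n (proj₂ v))))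

module EvenStraightEdges (m : ℕ) where

  r : ℕ
  r = suc (m * 2)

  Index : Set
  Index = Fin (suc m) × Vec Bool (m * 2)

  edgeAt : Index → Edge (BFAdj r)
  edgeAt (t , v) = straightEdge (double t) (insertAt v (double t) false)

  indices : List Index
  indices = cartesianProduct (allFin (suc m)) (allVecs (m * 2))

  K : List (Edge (BFAdj r))
  K = map edgeAt indices

  edgeAt-independent : ∀ {p q} → p ≢ q → Independent (edgeAt p) (edgeAt q)
  edgeAt-independent {t , v} {t′ , v′} p≢q = straightEdge-independent distinct
    (double≢suc-double t t′) (double≢suc-double t′ t ∘ sym)
    where
      distinct : double t ≡ double t′ → insertAt v (double t) false ≢ insertAt v′ (double t′) false
      distinct e with refl ← double-injective e = p≢q ∘ cong (t ,_) ∘ insertAt-injective (double t) false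

  K-independent : AllPairs Independent K
  K-independent = AllPairs.map⁺ (AllPairs.map edgeAt-independent
    (Unique.cartesianProduct⁺ (Unique.allFin⁺ (suc m)) (allVecs-unique (m * 2))))

  K-covers : CoversEvenStraightEdges (Endpoint K)
  K-covers s k w k-even bit with double-onto-even {m} k s k-even
  ... | t , refl = subst (λ w′ → Endpoint K (w′ , inject₁ k) × Endpoint K (w′ , fsuc k)) reinsert
    (endpoints-of-∈ (∈-map⁺ edgeAt (∈-cartesianProduct⁺ (∈-allFin t) (∈-allVecs (removeAt w k)))))
    where
      reinsert : insertAt (removeAt w k) k false ≡ w
      reinsert = trans (cong (insertAt (removeAt w k) k) (sym bit)) (insertAt-removeAt w k)

  length-K : length K ≡ suc m * 2 ^ (m * 2)
  length-K = begin
    length (map edgeAt indices)                      ≡⟨ length-map edgeAt indices ⟩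
    length indices                                   ≡⟨ length-cartesianProductWith _,_ (allFin (suc m)) (allVecs (m * 2)) ⟩
    length (allFin (suc m)) * length (allVecs (m * 2)) ≡⟨ cong₂ _*_ (length-tabulate {n = suc m} id) (length-allVecs (m * 2)) ⟩
    suc m * 2 ^ (m * 2)                              ∎
    where open ≡-Reasoning

  ζₑ-bound : ζₑ≤ (BFAdj r) (suc m * 2 ^ (m * 2))
  ζₑ-bound = K , (K-independent , Forcing.closure-total m K-covers) , ≤-reflexive length-K

lemma4p8 : (r : ℕ) → 3 ≤ r → r % 2 ≡ 1 →
    ζₑ≤ (BFAdj r) (⌈ r /2⌉ * 2 ^ (r ∸ 1))
lemma4p8 r _ r-odd = subst (λ n → ζₑ≤ (BFAdj n) (⌈ n /2⌉ * 2 ^ (n ∸ 1))) (sym r≡2m+1) bound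
  where
    m = r / 2
    r≡2m+1 : r ≡ suc (m * 2)
    r≡2m+1 = trans (m≡m%n+[m/n]*n r 2) (cong (_+ m * 2) r-odd)
    bound : ζₑ≤ (BFAdj (suc (m * 2))) (⌈ suc (m * 2) /2⌉ * 2 ^ (m * 2))
    bound = subst (λ c → ζₑ≤ (BFAdj (suc (m * 2))) (suc c * 2 ^ (m * 2)))
      (sym (⌊n*2/2⌋≡n m)) (EvenStraightEdges.ζₑ-bound m)
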